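{- Let $T$ be a tree of order $n \geq 4$ with maximum degree $\Delta(T) \geq 3$. Then $$\mathrm{hc}(T) \geq (n-1)(n-1-\zeta(T)) + \zeta'(T) - 2\mathcal{L}_W(T).$$
   Context: For a connected graph $G$ of order $n$, the detour distance $D(u,v)$ is the length of a longest $u$–$v$ path (in a tree it equals the ordinary distance $d(u,v)$). A hamiltonian coloring of $G$ is a map $h: V(G) \to \{0,1,2,\ldots\}$ such that $D(u,v) + |h(u)-h(v)| \geq n-1$ for all distinct $u,v \in V(G)$. Its span is $\max\{|h(u)-h(v)| : u,v \in V(G)\}$, and the hamiltonian chromatic number $\mathrm{hc}(G)$ is the minimum span over all hamiltonian colorings of $G$. For a tree $T$ and $v \in V(T)$ let $w_T(v) = \sum_{u \in V(T)} d(u,v)$; a weight center of $T$ is a vertex minimizing $w_T$, and $W(T)$ denotes the set of weight centers (it consists of one vertex $w$, or of two adjacent vertices $w,w'$). Set $\zeta(T) = 0$ if $|W(T)| = 1$ and $\zeta(T) = 1$ if $|W(T)| = 2$, and $\zeta'(T) = 1 - \zeta(T)$. For $u \in V(T)$ let $\mathcal{L}(u) = \min\{D(u,x) : x \in W(T)\}$, and let $\mathcal{L}_W(T) = \sum_{u \in V(T)} \mathcal{L}(u)$. -}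

module Defs where

open import Data.Bool using (Bool; true; false; if_then_else_; T)
open import Data.Nat using (ℕ; zero; suc; _+_; _*_; _∸_; _≤_; _≤ᵇ_; _⊓_; _⊔_; ∣_-_∣)
open import Data.Fin using (Fin; zero; suc; inject₁; fromℕ)
open import Data.List using (List; []; _∷_; map; foldr; allFin; filterᵇ; concatMap)
open import Data.Nat.ListAction using (sum)
open import Data.Bool.ListAction using (all)
open import Data.Product using (Σ; ∃; _×_; _,_)
open import Relation.Binary.PropositionalEquality using (_≡_; _≢_)
open import Relation.Nullary using (¬_)
open import Function.Definitions using (Injective)

Adj : ℕ → Set
Adj n = Fin n → Fin n → Bool

IsSimpleGraph : ∀ {n} → Adj n → Set
IsSimpleGraph {n} adj = (∀ u v → adj u v ≡ adj v u) × (∀ v → adj v v ≡ false)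

data Walk {n : ℕ} (adj : Adj n) : Fin n → Fin n → ℕ → Set where
  here : ∀ {u} → Walk adj u u 0
  step : ∀ {u w v k} → T (adj u w) → Walk adj w v k → Walk adj u v (suc k)

Connected : ∀ {n} → Adj n → Set
Connected {n} adj = ∀ (u v : Fin n) → ∃ λ k → Walk adj u v k

HasCycle : ∀ {n} → Adj n → Set
HasCycle {n} adj =
  ∃ λ m → Σ (Fin (suc (suc (suc m))) → Fin n) λ c →
    Injective _≡_ _≡_ c
    × (∀ (i : Fin (suc (suc m))) → adj (c (inject₁ i)) (c (suc i)) ≡ true)
    × adj (c (fromℕ (suc (suc m)))) (c zero) ≡ true

IsTree : ∀ {n} → Adj n → Set
IsTree adj = IsSimpleGraph adj × Connected adj × ¬ HasCycle adj

degree : ∀ {n} → Adj n → Fin n → ℕ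
degree {n} adj v = sum (map (λ w → if adj v w then 1 else 0) (allFin n))

IsDistance : ∀ {n} → Adj n → (Fin n → Fin n → ℕ) → Set
IsDistance adj d =
  ∀ u v → Walk adj u v (d u v) × (∀ k → Walk adj u v k → d u v ≤ k)

-- In the following, d is the distance function of the tree
-- (which coincides with the detour distance D in a tree).

weight : ∀ {n} → (Fin n → Fin n → ℕ) → Fin n → ℕ
weight {n} d v = sum (map (λ u → d u v) (allFin n))

isWeightCenter : ∀ {n} → (Fin n → Fin n → ℕ) → Fin n → Bool
isWeightCenter {n} d x = all (λ u → weight d x ≤ᵇ weight d u) (allFin n)

weightCenters : ∀ {n} → (Fin n → Fin n → ℕ) → List (Fin n)
weightCenters {n} d = filterᵇ (isWeightCenter d) (allFin n)

numWeightCenters : ∀ {n} → (Fin n → Fin n → ℕ) → ℕ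
numWeightCenters {n} d = sum (map (λ x → if isWeightCenter d x then 1 else 0) (allFin n))

ζ : ∀ {n} → (Fin n → Fin n → ℕ) → ℕ
ζ d = if 2 ≤ᵇ numWeightCenters d then 1 else 0

ζ′ : ∀ {n} → (Fin n → Fin n → ℕ) → ℕ
ζ′ d = 1 ∸ ζ d

-- minimum of a list (0 for the empty list; W(T) is never empty)
minList : List ℕ → ℕ
minList [] = 0
minList (x ∷ xs) = foldr _⊓_ x xs

maxList : List ℕ → ℕ
maxList = foldr _⊔_ 0

level : ∀ {n} → (Fin n → Fin n → ℕ) → Fin n → ℕ
level d u = minList (map (d u) (weightCenters d))

totalLevel : ∀ {n} → (Fin n → Fin n → ℕ) → ℕ
totalLevel {n} d = sum (map (level d) (allFin n))

IsHamiltonianColoring : ∀ {n} → (Fin n → Fin n → ℕ) → (Fin n → ℕ) → Set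
IsHamiltonianColoring {n} D h = ∀ u v → u ≢ v → n ∸ 1 ≤ D u v + ∣ h u - h v ∣

span : ∀ {n} → (Fin n → ℕ) → ℕ
span {n} h = maxList (concatMap (λ u → map (λ v → ∣ h u - h v ∣) (allFin n)) (allFin n))

{-# OPTIONS --safe #-}
module Submission where

-- List the vertices as x₀, …, x_{n-1} with non-decreasing colors. For consecutive vertices the
-- hamiltonian condition gives h(x_{i+1}) - h(x_i) ≥ n - 1 - d(x_i, x_{i+1}), and going through the
-- weight centers nearest to them gives d(x, y) ≤ L(x) + L(y) + ζ(T), because distinct weight centers
-- are adjacent. Summing the n - 1 gaps,
--   span h ≥ h(x_{n-1}) - h(x₀) ≥ (n-1)(n-1-ζ(T)) - 2 L_W(T) + L(x₀) + L(x_{n-1}),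
-- and when the weight center is unique only one vertex has level 0, which yields the extra ζ′(T) = 1.
-- Weight centers are adjacent because w_T is strictly convex along paths: 2 w(b) < w(a) + w(c) for
-- distinct neighbors a, c of b. Indeed every vertex u sees a and c at distance d(b,u) ± 1, and not
-- both at d(b,u) - 1: two vertices at equal distance from u are joined by a path through vertices
-- no farther from u, which b would close into a cycle.

open import Defs
open import Data.Bool using (true; false; if_then_else_; T)
open import Data.Bool.Properties using (T-≡)
open import Data.Nat using (ℕ; zero; suc; _+_; _*_; _∸_; _≤_; _<_; _≤ᵇ_; _⊓_; _⊔_; ∣_-_∣; z≤n; s≤s; s≤s⁻¹)
open import Data.Nat.Properties hiding (_≟_)
open import Algebra.Properties.CommutativeSemigroup +-commutativeSemigroup using () renaming (interchange to +-interchange)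
open import Data.Nat.ListAction using (sum)
open import Data.Nat.ListAction.Properties using (sum-↭)
open import Data.Nat.Tactic.RingSolver using (solve-∀)
open import Data.Fin using (Fin; zero; suc; toℕ; inject₁; fromℕ; _≟_)
open import Data.Fin.Properties using (toℕ-injective; toℕ<n; toℕ≤pred[n]; toℕ-inject₁; toℕ-fromℕ)
open import Data.Integer using (+_; _-_; _⊖_) renaming (_≤_ to _≤ℤ_)
import Data.Integer.Properties as ℤ
open import Data.List using (List; []; _∷_; map; allFin; length)
open import Data.List.Properties using (foldr-preservesᵇ; foldr-preservesᵒ; length-tabulate)
open import Data.List.Membership.Propositional using (_∈_)
open import Data.List.Membership.Propositional.Properties using (∈-allFin; ∈-map⁺; ∈-map⁻; ∈-filter⁺; ∈-filter⁻; ∈-concatMap⁺)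
open import Data.List.Relation.Unary.All as All using (All)
open import Data.List.Relation.Unary.All.Properties using (all⁺; all⁻)
open import Data.List.Relation.Unary.Any as Any using (here; there)
open import Data.List.Relation.Unary.AllPairs using (_∷_)
open import Data.List.Relation.Unary.Linked as Linked using (Linked; [-]; _∷_)
open import Data.List.Relation.Unary.Linked.Properties using (AllPairs⇒Linked)
open import Data.List.Relation.Unary.Unique.Propositional using (Unique)
open import Data.List.Relation.Unary.Unique.Propositional.Properties using (allFin⁺)
open import Data.List.Relation.Binary.Permutation.Propositional using (_↭_; ↭-sym; ↭⇒↭ₛ)
open import Data.List.Relation.Binary.Permutation.Propositional.Properties using (↭-length; map⁺)
import Data.List.Relation.Binary.Permutation.Setoid.Properties as Permutationₛ
import Data.List.Sort as Sort
open import Data.List.Extrema.Nat using (argmin; f[argmin]≤f[xs])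
open import Data.Product using (Σ; ∃; ∃-syntax; ∃₂; _×_; _,_; proj₁; proj₂)
open import Data.Sum using (_⊎_; inj₁; inj₂; [_,_]′)
open import Function using (_∘_; Equivalence)
open import Relation.Nullary using (¬_; yes; no; contradiction)
open import Relation.Nullary.Decidable using (T?)
open import Relation.Binary.Definitions using (tri<; tri≈; tri>)
open import Relation.Binary.PropositionalEquality
import Relation.Binary.Construct.On as On

strictly-convex-step : ∀ {a b c} → b + b < a + c → a ≤ b → b < c
strictly-convex-step {a} {b} {c} 2b<a+c a≤b = +-cancelˡ-< b b c (<-≤-trans 2b<a+c (+-monoˡ-≤ c a≤b))

m≤o+n⇒+m-+n≤+o : ∀ {m n o} → m ≤ o + n → + m - + n ≤ℤ + o
m≤o+n⇒+m-+n≤+o {m} {n} {o} m≤o+n = begin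
  + m - + n       ≡⟨ ℤ.m-n≡m⊖n m n ⟩
  m ⊖ n           ≤⟨ ℤ.⊖-monoˡ-≤ n m≤o+n ⟩
  (o + n) ⊖ n     ≡⟨ ℤ.⊖-≥ (m≤n+m n o) ⟩
  + (o + n ∸ n)   ≡⟨ cong +_ (m+n∸n≡m o n) ⟩
  + o             ∎
  where open ℤ.≤-Reasoning

ζ-bound : ∀ {N z L S T} → z ≤ 1 → (z ≡ 0 → 1 ≤ L) → N * N + L ≤ S + (2 * T + N * z) →
          + (N * (N ∸ z) + (1 ∸ z)) - + (2 * T) ≤ℤ + S
ζ-bound {N} {L = L} {S} {T} z≤n 1≤L bound = m≤o+n⇒+m-+n≤+o (begin
  N * N + 1                 ≤⟨ +-monoʳ-≤ (N * N) (1≤L refl) ⟩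
  N * N + L                 ≤⟨ bound ⟩
  S + (2 * T + N * 0)       ≡⟨ cong (λ s → S + (2 * T + s)) (*-zeroʳ N) ⟩
  S + (2 * T + 0)           ≡⟨ cong (λ s → S + s) (+-identityʳ (2 * T)) ⟩
  S + 2 * T                 ∎)
  where open ≤-Reasoning
ζ-bound {N} {L = L} {S} {T} (s≤s z≤n) _ bound = m≤o+n⇒+m-+n≤+o (begin
  N * (N ∸ 1) + 0           ≡⟨ +-identityʳ (N * (N ∸ 1)) ⟩
  N * (N ∸ 1)               ≡⟨ *-distribˡ-∸ N N 1 ⟩
  N * N ∸ N * 1             ≤⟨ m≤n+o⇒m∸n≤o (N * N) (N * 1) N*N≤ ⟩
  S + 2 * T                 ∎)
  where
    open ≤-Reasoning
    N*N≤ : N * N ≤ N * 1 + (S + 2 * T)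
    N*N≤ = begin
      N * N                 ≤⟨ m≤m+n (N * N) L ⟩
      N * N + L             ≤⟨ bound ⟩
      S + (2 * T + N * 1)   ≡⟨ sym (+-assoc S (2 * T) (N * 1)) ⟩
      S + 2 * T + N * 1     ≡⟨ +-comm (S + 2 * T) (N * 1) ⟩
      N * 1 + (S + 2 * T)   ∎

module _ {A : Set} where

  sum-map-+ : ∀ (f g : A → ℕ) xs → sum (map (λ x → f x + g x) xs) ≡ sum (map f xs) + sum (map g xs)
  sum-map-+ f g []       = refl
  sum-map-+ f g (x ∷ xs) =
    trans (cong (λ s → f x + g x + s) (sum-map-+ f g xs)) (+-interchange (f x) (g x) _ _)

  sum-map-mono-≤ : ∀ {f g : A → ℕ} → (∀ x → f x ≤ g x) → ∀ xs → sum (map f xs) ≤ sum (map g xs)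
  sum-map-mono-≤ f≤g []       = z≤n
  sum-map-mono-≤ f≤g (x ∷ xs) = +-mono-≤ (f≤g x) (sum-map-mono-≤ f≤g xs)

  sum-map-mono-< : ∀ {f g : A → ℕ} {y xs} → (∀ x → f x ≤ g x) → y ∈ xs → f y < g y →
                   sum (map f xs) < sum (map g xs)
  sum-map-mono-< {xs = _ ∷ xs} f≤g (here refl) fy<gy = +-mono-<-≤ fy<gy (sum-map-mono-≤ f≤g xs)
  sum-map-mono-< f≤g (there y∈xs) fy<gy = +-mono-≤-< (f≤g _) (sum-map-mono-< f≤g y∈xs fy<gy)

  f[x]≤sum : ∀ (f : A → ℕ) {x xs} → x ∈ xs → f x ≤ sum (map f xs)
  f[x]≤sum f (here refl)  = m≤m+n _ _
  f[x]≤sum f (there x∈xs) = ≤-trans (f[x]≤sum f x∈xs) (m≤n+m _ _)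

  f[x]+f[y]≤sum : ∀ (f : A → ℕ) {x y xs} → x ≢ y → x ∈ xs → y ∈ xs → f x + f y ≤ sum (map f xs)
  f[x]+f[y]≤sum f x≢y (here refl)  (here refl)  = contradiction refl x≢y
  f[x]+f[y]≤sum f x≢y (here refl)  (there y∈xs) = +-monoʳ-≤ _ (f[x]≤sum f y∈xs)
  f[x]+f[y]≤sum f {x} {y} {_ ∷ xs} x≢y (there x∈xs) (here refl) =
    subst (_≤ f y + sum (map f xs)) (+-comm (f y) (f x)) (+-monoʳ-≤ (f y) (f[x]≤sum f x∈xs))
  f[x]+f[y]≤sum f x≢y (there x∈xs) (there y∈xs) =
    ≤-trans (f[x]+f[y]≤sum f x≢y x∈xs y∈xs) (m≤n+m _ _)

  lastOf : A → List A → A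
  lastOf x []       = x
  lastOf _ (y ∷ ys) = lastOf y ys

  lastOf-∈ : ∀ x xs → lastOf x xs ∈ x ∷ xs
  lastOf-∈ x []       = here refl
  lastOf-∈ _ (y ∷ ys) = there (lastOf-∈ y ys)

minList-∈ : ∀ {x xs} → x ∈ xs → minList xs ∈ xs
minList-∈ {xs = y ∷ ys} _ = foldr-preservesᵇ ⊓-preserves (here refl) (All.tabulate there)
  where
    ⊓-preserves : ∀ {a b} → a ∈ y ∷ ys → b ∈ y ∷ ys → a ⊓ b ∈ y ∷ ys
    ⊓-preserves {a} {b} a∈ b∈ =
      [ (λ eq → subst (_∈ y ∷ ys) (sym eq) a∈) , (λ eq → subst (_∈ y ∷ ys) (sym eq) b∈) ]′ (⊓-sel a b)

∈⇒≤maxList : ∀ {x xs} → x ∈ xs → x ≤ maxList xs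
∈⇒≤maxList {x} {xs} x∈xs = foldr-preservesᵒ ⊔-preserves 0 xs (inj₂ (Any.map ≤-reflexive x∈xs))
  where
    ⊔-preserves : ∀ a b → x ≤ a ⊎ x ≤ b → x ≤ a ⊔ b
    ⊔-preserves a b = [ (λ x≤a → ≤-trans x≤a (m≤m⊔n a b)) , (λ x≤b → ≤-trans x≤b (m≤n⊔m a b)) ]′

∣h-h∣≤span : ∀ {n} (h : Fin n → ℕ) a b → ∣ h a - h b ∣ ≤ span h
∣h-h∣≤span {n} h a b =
  ∈⇒≤maxList (∈-concatMap⁺ row (Any.map (λ where refl → ∈-map⁺ _ (∈-allFin b)) (∈-allFin a)))
  where
    row : Fin n → List ℕ
    row u = map (λ v → ∣ h u - h v ∣) (allFin n)

if-T : ∀ {b} → T b → (if b then 1 else 0) ≡ 1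
if-T {true} _ = refl

ζ≡0⇒numWeightCenters<2 : ∀ {n} {d : Fin n → Fin n → ℕ} → ζ d ≡ 0 → numWeightCenters d < 2
ζ≡0⇒numWeightCenters<2 ζ≡0 = ≰⇒> λ 2≤count →
  contradiction (trans (sym (if-T (≤⇒≤ᵇ 2≤count))) ζ≡0) λ ()

ζ≤1 : ∀ {n} (d : Fin n → Fin n → ℕ) → ζ d ≤ 1
ζ≤1 d = if≤1 (2 ≤ᵇ numWeightCenters d)
  where
    if≤1 : ∀ b → (if b then 1 else 0) ≤ 1
    if≤1 true  = ≤-refl
    if≤1 false = z≤n

module Telescope {A : Set} (h L : A → ℕ) (N Z : ℕ) where

  Gap : A → A → Set
  Gap x y = h x + N ≤ h y + (L x + L y + Z)

  gap-telescope : ∀ x xs → Linked Gap (x ∷ xs) →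
    h x + (length xs * N + (L x + L (lastOf x xs)))
      ≤ h (lastOf x xs) + (2 * sum (map L (x ∷ xs)) + length xs * Z)
  gap-telescope x []       [-]             = ≤-reflexive (base (h x) (L x))
    where
      base : ∀ a l → a + (0 + (l + l)) ≡ a + (2 * (l + 0) + 0)
      base = solve-∀
  gap-telescope x (y ∷ ys) (gap ∷ linked) = +-cancelʳ-≤ (h y + L y) _ _ (begin
    h x + (suc k * N + (L x + L ℓ)) + (h y + L y)
      ≡⟨ split-left (h x) (h y) (L x) (L y) (L ℓ) k N ⟩
    (h x + N) + (h y + (k * N + (L y + L ℓ))) + L x
      ≤⟨ +-monoˡ-≤ (L x) (+-mono-≤ gap (gap-telescope y ys linked)) ⟩
    h y + (L x + L y + Z) + (h ℓ + (2 * (L y + S) + k * Z)) + L x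
      ≡⟨ join-right (h y) (h ℓ) (L x) (L y) S k Z ⟩
    h ℓ + (2 * (L x + (L y + S)) + suc k * Z) + (h y + L y) ∎)
    where
      open ≤-Reasoning
      k = length ys
      ℓ = lastOf y ys
      S = sum (map L ys)
      split-left : ∀ a b lx ly lℓ k N →
        a + (suc k * N + (lx + lℓ)) + (b + ly) ≡ (a + N) + (b + (k * N + (ly + lℓ))) + lx
      split-left = solve-∀
      join-right : ∀ b c lx ly s k Z →
        b + (lx + ly + Z) + (c + (2 * (ly + s) + k * Z)) + lx ≡ c + (2 * (lx + (ly + s)) + suc k * Z) + (b + ly)
      join-right = solve-∀

module Tree {n : ℕ} {adj : Adj n} {d : Fin n → Fin n → ℕ}
            (tree : IsTree adj) (distance : IsDistance adj d) where

  Adjacent : Fin n → Fin n → Set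
  Adjacent u v = T (adj u v)

  adjacent-sym : ∀ {u v} → Adjacent u v → Adjacent v u
  adjacent-sym {u} {v} = subst T (proj₁ (proj₁ tree) u v)

  adjacent-irrefl : ∀ {u v} → Adjacent u v → u ≢ v
  adjacent-irrefl {u} u~u refl = subst T (proj₂ (proj₁ tree) u) u~u

  acyclic : ¬ HasCycle adj
  acyclic = proj₂ (proj₂ tree)

  _++ʷ_ : ∀ {u v w k l} → Walk adj u v k → Walk adj v w l → Walk adj u w (k + l)
  here     ++ʷ q = q
  step e p ++ʷ q = step e (p ++ʷ q)

  reverseʷ : ∀ {u v k} → Walk adj u v k → Walk adj v u k
  reverseʷ here               = here
  reverseʷ (step {k = k} e p) =
    subst (Walk adj _ _) (+-comm k 1) (reverseʷ p ++ʷ step (adjacent-sym e) here)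

  first-step : ∀ {u v k} → Walk adj u v (suc k) → ∃[ w ] Adjacent u w × Walk adj w v k
  first-step (step e p) = _ , e , p

  dist-walk : ∀ u v → Walk adj u v (d u v)
  dist-walk u v = proj₁ (distance u v)

  dist-≤ : ∀ {u v k} → Walk adj u v k → d u v ≤ k
  dist-≤ {u} {v} {k} = proj₂ (distance u v) k

  dist-sym : ∀ u v → d u v ≡ d v u
  dist-sym u v = ≤-antisym (dist-≤ (reverseʷ (dist-walk v u))) (dist-≤ (reverseʷ (dist-walk u v)))

  dist-triangle : ∀ u v w → d u w ≤ d u v + d v w
  dist-triangle u v w = dist-≤ (dist-walk u v ++ʷ dist-walk v w)

  dist-refl : ∀ u → d u u ≡ 0
  dist-refl u = n≤0⇒n≡0 (dist-≤ (here {u = u}))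

  dist≡0⇒≡ : ∀ {u v} → d u v ≡ 0 → u ≡ v
  dist≡0⇒≡ {u} {v} eq = walk-0 (subst (Walk adj u v) eq (dist-walk u v))
    where
      walk-0 : ∀ {u v} → Walk adj u v 0 → u ≡ v
      walk-0 here = refl

  dist-pos : ∀ {u v} → u ≢ v → 0 < d u v
  dist-pos u≢v = n≢0⇒n>0 (u≢v ∘ dist≡0⇒≡)

  dist-adjacent-≤ : ∀ {a b} → Adjacent a b → ∀ u → d a u ≤ suc (d b u)
  dist-adjacent-≤ {a} {b} a~b u = ≤-trans (dist-triangle a b u) (+-monoˡ-≤ (d b u) (dist-≤ (step a~b here)))

  closer-neighbor : ∀ {a u m} → d a u ≡ suc m → ∃[ a′ ] Adjacent a a′ × d a′ u ≡ m
  closer-neighbor {a} {u} eq with first-step (subst (Walk adj a u) eq (dist-walk a u))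
  ... | a′ , a~a′ , p = a′ , a~a′ , ≤-antisym (dist-≤ p)
                          (s≤s⁻¹ (subst (_≤ suc (d a′ u)) eq (dist-adjacent-≤ a~a′ u)))

  record Path (a c : Fin n) (len : ℕ) : Set where
    field
      vertex    : ℕ → Fin n
      vertex-0  : vertex 0 ≡ a
      vertex-len : vertex len ≡ c
      adjacent  : ∀ {t} → t < len → Adjacent (vertex t) (vertex (suc t))
      injective : ∀ {s t} → s ≤ len → t ≤ len → vertex s ≡ vertex t → s ≡ t

  open Path

  record Along (S : Fin n → Set) {a c len} (P : Path a c len) : Set where
    constructor along
    field
      at : ∀ {t} → t ≤ len → S (vertex P t)

  open Along

  Along-map : ∀ {a c len} {S S′ : Fin n → Set} {P : Path a c len} →
              (∀ {v} → S v → S′ v) → Along S P → Along S′ P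
  Along-map f P⊆S = along λ t≤len → f (at P⊆S t≤len)

  [_]ᵖ : ∀ v → Path v v 0
  [ v ]ᵖ = record
    { vertex = λ _ → v ; vertex-0 = refl ; vertex-len = refl ; adjacent = λ ()
    ; injective = λ s≤0 t≤0 _ → trans (n≤0⇒n≡0 s≤0) (sym (n≤0⇒n≡0 t≤0)) }

  prepend : ∀ {a b c len} → Adjacent a b → (P : Path b c len) → Along (a ≢_) P → Path a c (suc len)
  prepend {a} {len = len} a~b P a∉P = record
    { vertex = vertex′ ; vertex-0 = refl ; vertex-len = vertex-len P
    ; adjacent = adjacent′ ; injective = injective′ }
    where
      vertex′ : ℕ → Fin n
      vertex′ zero    = a
      vertex′ (suc t) = vertex P t
      adjacent′ : ∀ {t} → t < suc len → Adjacent (vertex′ t) (vertex′ (suc t))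
      adjacent′ {zero}  _          = subst (Adjacent a) (sym (vertex-0 P)) a~b
      adjacent′ {suc t} (s≤s t<len) = adjacent P t<len
      injective′ : ∀ {s t} → s ≤ suc len → t ≤ suc len → vertex′ s ≡ vertex′ t → s ≡ t
      injective′ {zero}  {zero}  _         _         _  = refl
      injective′ {zero}  {suc t} _         (s≤s t≤len) eq = contradiction eq (at a∉P t≤len)
      injective′ {suc s} {zero}  (s≤s s≤len) _         eq = contradiction (sym eq) (at a∉P s≤len)
      injective′ {suc s} {suc t} (s≤s s≤len) (s≤s t≤len) eq = cong suc (injective P s≤len t≤len eq)

  Along-prepend : ∀ {a b c len} {S : Fin n → Set} {a~b : Adjacent a b} {P : Path b c len} {a∉P : Along (a ≢_) P} →
                  S a → Along S P → Along S (prepend a~b P a∉P)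
  Along-prepend {len = len} {S} Sa P⊆S = along at′
    where
      at′ : ∀ {t} → t ≤ suc len → S _
      at′ {zero}  _           = Sa
      at′ {suc t} (s≤s t≤len) = at P⊆S t≤len

  reverse : ∀ {a c len} → Path a c len → Path c a len
  reverse {a} {c} {len} P = record
    { vertex = vertex′ ; vertex-0 = vertex-len P
    ; vertex-len = trans (cong (vertex P) (n∸n≡0 len)) (vertex-0 P)
    ; adjacent = adjacent′ ; injective = injective′ }
    where
      vertex′ : ℕ → Fin n
      vertex′ t = vertex P (len ∸ t)
      adjacent′ : ∀ {t} → t < len → Adjacent (vertex′ t) (vertex′ (suc t))
      adjacent′ {t} t<len = subst (λ s → Adjacent (vertex P s) (vertex′ (suc t))) (sym len∸t≡)
                              (adjacent-sym (adjacent P (subst (_≤ len) len∸t≡ (m∸n≤m len t))))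
        where
          len∸t≡ : len ∸ t ≡ suc (len ∸ suc t)
          len∸t≡ = +-∸-assoc 1 t<len
      injective′ : ∀ {s t} → s ≤ len → t ≤ len → vertex′ s ≡ vertex′ t → s ≡ t
      injective′ {s} {t} s≤len t≤len eq =
        ∸-cancelˡ-≡ s≤len t≤len (injective P (m∸n≤m len s) (m∸n≤m len t) eq)

  Along-reverse : ∀ {a c len} {S : Fin n → Set} {P : Path a c len} → Along S P → Along S (reverse P)
  Along-reverse {len = len} P⊆S = along λ {t} _ → at P⊆S (m∸n≤m len t)

  append : ∀ {a b c len} → (P : Path a b len) → Adjacent b c → Along (c ≢_) P → Path a c (suc len)
  append P b~c c∉P = reverse (prepend (adjacent-sym b~c) (reverse P) (Along-reverse c∉P))

  Along-append : ∀ {a b c len} {S : Fin n → Set} {P : Path a b len} {b~c : Adjacent b c} {c∉P : Along (c ≢_) P} →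
                 S c → Along S P → Along S (append P b~c c∉P)
  Along-append Sc P⊆S = Along-reverse (Along-prepend Sc (Along-reverse P⊆S))

  path⇒cycle : ∀ {a c m} → Path a c (suc (suc m)) → Adjacent c a → HasCycle adj
  path⇒cycle {m = m} P c~a = m , vertex P ∘ toℕ , injective′ , adjacent′ , closing
    where
      injective′ : ∀ {i j} → vertex P (toℕ i) ≡ vertex P (toℕ j) → i ≡ j
      injective′ {i} {j} eq = toℕ-injective (injective P (toℕ≤pred[n] i) (toℕ≤pred[n] j) eq)
      adjacent′ : ∀ i → adj (vertex P (toℕ (inject₁ i))) (vertex P (toℕ (suc i))) ≡ true
      adjacent′ i rewrite toℕ-inject₁ i = Equivalence.to T-≡ (adjacent P (toℕ<n i))
      closing : adj (vertex P (toℕ (fromℕ (suc (suc m))))) (vertex P 0) ≡ true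
      closing rewrite toℕ-fromℕ (suc (suc m)) | vertex-len P | vertex-0 P = Equivalence.to T-≡ c~a

  Within : Fin n → ℕ → Fin n → Set
  Within u m v = d v u ≤ m

  beyond⇒≢ : ∀ {u m x v} → d x u ≡ suc m → Within u m v → x ≢ v
  beyond⇒≢ {m = m} dx dv refl = 1+n≰n (subst (_≤ m) dx dv)

  wrap : ∀ {u m a a′ c c′ len} → Adjacent a a′ → Adjacent c c′ → a ≢ c → d a u ≡ suc m → d c u ≡ suc m →
         (P : Path a′ c′ len) → Along (Within u m) P → Σ (Path a c (suc (suc len))) (Along (Within u (suc m)))
  wrap {a = a} {c = c} a~a′ c~c′ a≢c da dc P below =
    prepend a~a′ P′ a∉P′ ,
    Along-prepend (≤-reflexive da) (Along-append {c∉P = c∉P} (≤-reflexive dc) (Along-map m≤n⇒m≤1+n below))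
    where
      c∉P : Along (c ≢_) P
      c∉P = Along-map (beyond⇒≢ dc) below
      P′ = append P (adjacent-sym c~c′) c∉P
      a∉P′ : Along (a ≢_) P′
      a∉P′ = Along-append {c∉P = c∉P} a≢c (Along-map (beyond⇒≢ da) below)

  equidistant-path : ∀ u m {a c} → a ≢ c → d a u ≡ m → d c u ≡ m →
                     ∃[ len ] Σ (Path a c (suc (suc len))) (Along (Within u m))
  equidistant-path u zero a≢c da dc = contradiction (trans (dist≡0⇒≡ da) (sym (dist≡0⇒≡ dc))) a≢c
  equidistant-path u (suc m) a≢c da dc with closer-neighbor da | closer-neighbor dc
  ... | a′ , a~a′ , da′ | c′ , c~c′ , dc′ with a′ ≟ c′
  ... | yes refl = 0 , wrap a~a′ c~c′ a≢c da dc [ a′ ]ᵖ (along λ _ → ≤-reflexive da′)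
  ... | no a′≢c′ with len , P , below ← equidistant-path u m a′≢c′ da′ dc′ =
    suc (suc len) , wrap a~a′ c~c′ a≢c da dc P below

  adjacent⇒dist≢ : ∀ {a c} → Adjacent a c → ∀ u → d a u ≢ d c u
  adjacent⇒dist≢ {a} a~c u eq with _ , P , _ ← equidistant-path u (d a u) (adjacent-irrefl a~c) refl (sym eq) =
    acyclic (path⇒cycle P (adjacent-sym a~c))

  unique-closer-neighbor : ∀ {a b c u m} → Adjacent b a → Adjacent b c → d b u ≡ suc m →
                           d a u ≡ m → d c u ≡ m → a ≡ c
  unique-closer-neighbor {a} {c = c} {u} {m} b~a b~c db da dc with a ≟ c
  ... | yes a≡c = a≡c
  ... | no a≢c with _ , P , P-below ← equidistant-path u m a≢c da dc =
    contradiction (path⇒cycle (prepend b~a P (Along-map (beyond⇒≢ db) P-below)) (adjacent-sym b~c)) acyclic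

  adjacent⇒dist≡suc : ∀ {a b} → Adjacent a b → ∀ u → d a u ≡ suc (d b u) ⊎ d b u ≡ suc (d a u)
  adjacent⇒dist≡suc {a} {b} a~b u with <-cmp (d a u) (d b u)
  ... | tri< da<db _ _ = inj₂ (≤-antisym (dist-adjacent-≤ (adjacent-sym a~b) u) da<db)
  ... | tri≈ _ da≡db _ = contradiction da≡db (adjacent⇒dist≢ a~b u)
  ... | tri> _ _ da>db = inj₁ (≤-antisym (dist-adjacent-≤ a~b u) da>db)

  dist-midpoint-convex : ∀ {a b c} → Adjacent b a → Adjacent b c → a ≢ c →
                         ∀ u → d b u + d b u ≤ d a u + d c u
  dist-midpoint-convex {a} {b} {c} b~a b~c a≢c u
    with adjacent⇒dist≡suc (adjacent-sym b~a) u | adjacent⇒dist≡suc (adjacent-sym b~c) u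
  ... | inj₁ da≡ | _ = begin
    d b u + d b u       ≤⟨ +-monoʳ-≤ (d b u) (dist-adjacent-≤ b~c u) ⟩
    d b u + suc (d c u) ≡⟨ +-suc (d b u) (d c u) ⟩
    suc (d b u) + d c u ≡⟨ cong (_+ d c u) (sym da≡) ⟩
    d a u + d c u       ∎
    where open ≤-Reasoning
  ... | inj₂ _ | inj₁ dc≡ = begin
    d b u + d b u       ≤⟨ +-monoˡ-≤ (d b u) (dist-adjacent-≤ b~a u) ⟩
    suc (d a u) + d b u ≡⟨ sym (+-suc (d a u) (d b u)) ⟩
    d a u + suc (d b u) ≡⟨ cong (λ s → d a u + s) (sym dc≡) ⟩
    d a u + d c u       ∎
    where open ≤-Reasoning
  ... | inj₂ db≡ | inj₂ db≡′ =
    contradiction (unique-closer-neighbor b~a b~c db≡ refl (suc-injective (trans (sym db≡′) db≡))) a≢c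

  weight-convex : ∀ {a b c} → Adjacent b a → Adjacent b c → a ≢ c →
                  weight d b + weight d b < weight d a + weight d c
  weight-convex {a} {b} {c} b~a b~c a≢c = begin-strict
    weight d b + weight d b                      ≡⟨ sym (sum-map-+ (λ u → d u b) (λ u → d u b) (allFin n)) ⟩
    sum (map (λ u → d u b + d u b) (allFin n))   <⟨ sum-map-mono-< pointwise (∈-allFin b) at-b ⟩
    sum (map (λ u → d u a + d u c) (allFin n))   ≡⟨ sum-map-+ (λ u → d u a) (λ u → d u c) (allFin n) ⟩
    weight d a + weight d c                      ∎
    where
      open ≤-Reasoning
      pointwise : ∀ u → d u b + d u b ≤ d u a + d u c
      pointwise u = subst₂ _≤_ (cong₂ _+_ (dist-sym b u) (dist-sym b u)) (cong₂ _+_ (dist-sym a u) (dist-sym c u))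
                      (dist-midpoint-convex b~a b~c a≢c u)
      at-b : d b b + d b b < d b a + d b c
      at-b rewrite dist-refl b = <-≤-trans (dist-pos (adjacent-irrefl b~a)) (m≤m+n (d b a) (d b c))

  IsCenter : Fin n → Set
  IsCenter x = ∀ v → weight d x ≤ weight d v

  weight-increases-away : ∀ {x} → IsCenter x → ∀ j {v p} →
                          d v x ≡ suc (suc j) → Adjacent v p → d p x ≡ suc j → weight d p < weight d v
  weight-increases-away {x} x-center j {v} {p} dv v~p dp with g , p~g , dg ← closer-neighbor dp =
    strictly-convex-step (weight-convex p~g (adjacent-sym v~p) g≢v) (w[g]≤w[p] j dg dp)
    where
      g≢v : g ≢ v
      g≢v refl = <⇒≢ (m<n⇒m<1+n (n<1+n j)) (trans (sym dg) dv)
      w[g]≤w[p] : ∀ k → d g x ≡ k → d p x ≡ suc k → weight d g ≤ weight d p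
      w[g]≤w[p] zero    dg _  rewrite dist≡0⇒≡ dg = x-center p
      w[g]≤w[p] (suc k) dg dp = <⇒≤ (weight-increases-away x-center k dp p~g dg)

  centers-close : ∀ {x y} → IsCenter x → IsCenter y → d y x ≤ 1
  centers-close {x} {y} x-center y-center with d y x in dyx
  ... | zero        = z≤n
  ... | suc zero    = ≤-refl
  ... | suc (suc j) with p , y~p , dp ← closer-neighbor dyx =
    contradiction (y-center p) (<⇒≱ (weight-increases-away x-center j dyx y~p dp))

  isWeightCenter⇒IsCenter : ∀ {x} → T (isWeightCenter d x) → IsCenter x
  isWeightCenter⇒IsCenter {x} x∈W v =
    ≤ᵇ⇒≤ _ _ (All.lookup (all⁺ (λ u → weight d x ≤ᵇ weight d u) (allFin n) x∈W) (∈-allFin v))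

  IsCenter⇒isWeightCenter : ∀ {x} → IsCenter x → T (isWeightCenter d x)
  IsCenter⇒isWeightCenter {x} x-center =
    all⁻ (λ u → weight d x ≤ᵇ weight d u) {allFin n} (All.tabulate λ {v} _ → ≤⇒≤ᵇ (x-center v))

  center-exists : Fin n → ∃ IsCenter
  center-exists v₀ = c , λ v → All.lookup (f[argmin]≤f[xs] {f = weight d} v₀ (allFin n)) (∈-allFin v)
    where c = argmin (weight d) v₀ (allFin n)

  centers-unique : ∀ {x y} → ζ d ≡ 0 → IsCenter x → IsCenter y → x ≡ y
  centers-unique {x} {y} ζ≡0 x-center y-center with x ≟ y
  ... | yes x≡y = x≡y
  ... | no x≢y  = contradiction two-centers (<⇒≱ (ζ≡0⇒numWeightCenters<2 {d = d} ζ≡0))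
    where
      indicator : Fin n → ℕ
      indicator v = if isWeightCenter d v then 1 else 0
      two-centers : 2 ≤ numWeightCenters d
      two-centers = ≤-trans (+-mono-≤ (≤-reflexive (sym (if-T (IsCenter⇒isWeightCenter x-center))))
                                      (≤-reflexive (sym (if-T (IsCenter⇒isWeightCenter y-center)))))
                            (f[x]+f[y]≤sum indicator x≢y (∈-allFin x) (∈-allFin y))

  centers-dist≤ζ : ∀ {x y} → IsCenter x → IsCenter y → d x y ≤ ζ d
  centers-dist≤ζ {x} {y} x-center y-center with ζ d in ζ≡
  ... | zero  rewrite centers-unique ζ≡ x-center y-center | dist-refl y = z≤n
  ... | suc _ = ≤-trans (centers-close y-center x-center) (s≤s z≤n)

  module _ (v₀ : Fin n) where

    weightCenters-nonempty : proj₁ (center-exists v₀) ∈ weightCenters d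
    weightCenters-nonempty = ∈-filter⁺ (T? ∘ isWeightCenter d) (∈-allFin _)
                               (IsCenter⇒isWeightCenter (proj₂ (center-exists v₀)))

    level-attained : ∀ u → ∃[ c ] IsCenter c × level d u ≡ d u c
    level-attained u =
      let c , c∈W , eq = ∈-map⁻ (d u) (minList-∈ (∈-map⁺ (d u) weightCenters-nonempty))
      in  c , isWeightCenter⇒IsCenter (proj₂ (∈-filter⁻ (T? ∘ isWeightCenter d) {xs = allFin n} c∈W)) , eq

    dist≤levels+ζ : ∀ x y → d x y ≤ level d x + level d y + ζ d
    dist≤levels+ζ x y =
      let c , c-center , lx = level-attained x
          c′ , c′-center , ly = level-attained y
          open ≤-Reasoning
      in  begin
      d x y                         ≤⟨ dist-triangle x c y ⟩
      d x c + d c y                 ≤⟨ +-monoʳ-≤ (d x c) (dist-triangle c c′ y) ⟩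
      d x c + (d c c′ + d c′ y)     ≤⟨ +-monoʳ-≤ (d x c) (+-monoˡ-≤ (d c′ y) (centers-dist≤ζ c-center c′-center)) ⟩
      d x c + (ζ d + d c′ y)        ≡⟨ cong₂ (λ p q → p + (ζ d + q)) (sym lx) (trans (dist-sym c′ y) (sym ly)) ⟩
      level d x + (ζ d + level d y) ≡⟨ cong (λ s → level d x + s) (+-comm (ζ d) (level d y)) ⟩
      level d x + (level d y + ζ d) ≡⟨ sym (+-assoc (level d x) (level d y) (ζ d)) ⟩
      level d x + level d y + ζ d   ∎

    level≡0⇒IsCenter : ∀ {x} → level d x ≡ 0 → IsCenter x
    level≡0⇒IsCenter {x} level≡0 =
      let c , c-center , lx = level-attained x
      in  subst IsCenter (sym (dist≡0⇒≡ (trans (sym lx) level≡0))) c-center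

    levels-pos : ∀ {x y} → ζ d ≡ 0 → x ≢ y → 0 < level d x + level d y
    levels-pos {x} {y} ζ≡0 x≢y = n≢0⇒n>0 λ sum≡0 →
      x≢y (centers-unique ζ≡0 (level≡0⇒IsCenter (m+n≡0⇒m≡0 (level d x) sum≡0))
                              (level≡0⇒IsCenter (m+n≡0⇒n≡0 (level d x) sum≡0)))

module HamiltonianColoring {N : ℕ} {adj : Adj (suc N)} {d : Fin (suc N) → Fin (suc N) → ℕ}
                            (tree : IsTree adj) (distance : IsDistance adj d)
                            {h : Fin (suc N) → ℕ} (ham : IsHamiltonianColoring d h) where

  open Tree tree distance using (dist≤levels+ζ)
  open Telescope h (level d) N (ζ d)
  open Sort (On.decTotalOrder ≤-decTotalOrder h) using (sort; sort-↭; sort-↗)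

  gap : ∀ {x y} → h x ≤ h y → x ≢ y → Gap x y
  gap {x} {y} hx≤hy x≢y = begin
    h x + N                         ≤⟨ +-monoʳ-≤ (h x) (ham x y x≢y) ⟩
    h x + (d x y + ∣ h x - h y ∣)   ≡⟨ cong (λ s → h x + (d x y + s)) ∣hx-hy∣≡hy∸hx ⟩
    h x + (d x y + (h y ∸ h x))     ≤⟨ +-monoʳ-≤ (h x) (+-monoˡ-≤ (h y ∸ h x) (dist≤levels+ζ zero x y)) ⟩
    h x + (B + (h y ∸ h x))         ≡⟨ cong (λ s → h x + s) (+-comm B (h y ∸ h x)) ⟩
    h x + ((h y ∸ h x) + B)         ≡⟨ sym (+-assoc (h x) (h y ∸ h x) B) ⟩
    h x + (h y ∸ h x) + B           ≡⟨ cong (_+ B) (m+[n∸m]≡n hx≤hy) ⟩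
    h y + B                         ∎
    where
      open ≤-Reasoning
      B = level d x + level d y + ζ d
      ∣hx-hy∣≡hy∸hx : ∣ h x - h y ∣ ≡ h y ∸ h x
      ∣hx-hy∣≡hy∸hx = trans (∣-∣-comm (h x) (h y)) (m≤n⇒∣n-m∣≡n∸m hx≤hy)

  sorted-listing-bound : ∀ {xs} → Unique xs → Linked (λ a b → h a ≤ h b) xs → length xs ≡ suc N → 1 ≤ N →
    ∃₂ λ x y → x ≢ y × N * N + (level d x + level d y) ≤ span h + (2 * sum (map (level d) xs) + N * ζ d)
  sorted-listing-bound {x ∷ []}     _                     _      refl ()
  sorted-listing-bound {x ∷ y ∷ ys} unique@(x∉ys ∷ _) sorted length≡ _ =
    x , ℓ , All.lookup x∉ys (lastOf-∈ y ys) , +-cancelˡ-≤ (h x) _ _ (begin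
      h x + (N * N + (level d x + level d ℓ))  ≡⟨ cong (λ m → h x + (m * N + (level d x + level d ℓ))) (sym k≡N) ⟩
      h x + (k * N + (level d x + level d ℓ))  ≤⟨ gap-telescope x (y ∷ ys) linked ⟩
      h ℓ + R k                                ≤⟨ +-monoˡ-≤ (R k) hℓ≤span+hx ⟩
      span h + h x + R k                       ≡⟨ cong (λ s → span h + h x + R s) k≡N ⟩
      span h + h x + R N                       ≡⟨ cong (_+ R N) (+-comm (span h) (h x)) ⟩
      h x + span h + R N                       ≡⟨ +-assoc (h x) (span h) (R N) ⟩
      h x + (span h + R N)                     ∎)
    where
      open ≤-Reasoning
      ℓ = lastOf y ys
      k = length (y ∷ ys)
      k≡N : k ≡ N
      k≡N = suc-injective length≡
      hℓ≤span+hx : h ℓ ≤ span h + h x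
      hℓ≤span+hx = ≤-trans (m≤∣m-n∣+n (h ℓ) (h x)) (+-monoˡ-≤ (h x) (∣h-h∣≤span h ℓ x))
      R : ℕ → ℕ
      R m = 2 * sum (map (level d) (x ∷ y ∷ ys)) + m * ζ d
      linked : Linked Gap (x ∷ y ∷ ys)
      linked = Linked.zipWith (λ (hx≤hy , x≢y) → gap hx≤hy x≢y) (sorted , AllPairs⇒Linked unique)

  color-order : List (Fin (suc N))
  color-order = sort (allFin (suc N))

  color-order-↭ : color-order ↭ allFin (suc N)
  color-order-↭ = sort-↭ (allFin (suc N))

  color-order-unique : Unique color-order
  color-order-unique =
    Permutationₛ.Unique-resp-↭ (setoid (Fin (suc N))) (↭⇒↭ₛ (↭-sym color-order-↭)) (allFin⁺ (suc N))

  color-order-length : length color-order ≡ suc N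
  color-order-length = trans (↭-length color-order-↭) (length-tabulate (λ v → v))

  color-order-sum : sum (map (level d) color-order) ≡ totalLevel d
  color-order-sum = sum-↭ (map⁺ (level d) color-order-↭)

  span-bound : 1 ≤ N →
    ∃₂ λ x y → x ≢ y × N * N + (level d x + level d y) ≤ span h + (2 * totalLevel d + N * ζ d)
  span-bound 1≤N =
    subst (λ s → ∃₂ λ x y → x ≢ y × N * N + (level d x + level d y) ≤ span h + (2 * s + N * ζ d))
          color-order-sum
          (sorted-listing-bound color-order-unique (sort-↗ (allFin (suc N))) color-order-length 1≤N)

theorem1 : (n : ℕ) (adj : Adj n) (d : Fin n → Fin n → ℕ) →
    IsTree adj → IsDistance adj d → 4 ≤ n → (∃ λ v → 3 ≤ degree adj v) →
    (h : Fin n → ℕ) → IsHamiltonianColoring d h →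
    + ((n ∸ 1) * (n ∸ 1 ∸ ζ d) + ζ′ d) - + (2 * totalLevel d) ≤ℤ + span h
theorem1 (suc N) adj d tree distance (s≤s 3≤N) _ h ham =
  let x , y , x≢y , bound = HamiltonianColoring.span-bound tree distance {h} ham (≤-trans (s≤s z≤n) 3≤N)
  in  ζ-bound {N} {T = totalLevel d} (ζ≤1 d) (λ ζ≡0 → Tree.levels-pos tree distance zero ζ≡0 x≢y) bound
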